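{- Let $\mathcal{T}$ be a collection of binary phylogenetic $X$-trees and let $S$ be a partial cherry picking sequence (containing no pair of the form $(x,-)$). Then every solution of $(\mathcal{T},S)$ has weight at least $k'(\mathcal{T},S)$.
   Context: A binary phylogenetic $X'$-tree is a rooted tree whose root has out-degree 2, whose internal non-root nodes have in-degree 1 and out-degree 2, and whose leaves are bijectively labelled by $X'$ (or a single node if $|X'|=1$). A pair $\{x,y\}$ is a cherry of a tree if leaves $x,y$ are siblings. A cherry picking sequence is a sequence $S=\langle (x_1,y_1),\dots,(x_r,y_r),(x_{r+1},-),\dots,(x_s,-)\rangle$ with $x_i,y_i\in X$; $|S|=s$; it is partial if $s=r$; $\circ$ denotes concatenation. Applying $S$ to a tree $T$: $T^{(0)}=T$, and for $j\le r$, if $\{x_j,y_j\}$ is a cherry of $T^{(j-1)}$ then $T^{(j)}$ is obtained by deleting leaf $x_j$ and suppressing the parent of $y_j$, otherwise $T^{(j)}=T^{(j-1)}$; $T/S=T^{(r)}$, $\mathcal{T}/S=\{T/S:T\in\mathcal{T}\}$. $S$ is a cherry picking sequence for $\mathcal{T}$ if $s>r$, $\{x_1,\dots,x_s\}=X$, and each $T/S$ ($T\in\mathcal{T}$) is a single leaf in $\{x_{r+1},\dots,x_s\}$. The weight is $w(S)=|S|-|X|$. A solution of $(\mathcal{T},S)$ is a sequence $S\circ S'$ that is a cherry picking sequence for $\mathcal{T}$. Define $n'(\mathcal{T},S)=|\{x\in X: x \text{ is a leaf of some tree in } \mathcal{T}/S\}|$ and $k'(\mathcal{T},S)=|S|-|X|+n'(\mathcal{T},S)$.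 -}

module Defs where

open import Data.Nat using (ℕ; _≡ᵇ_; _≟_)
open import Data.Bool using (Bool; true; false; _∧_; _∨_; if_then_else_)
open import Data.Product using (_×_; _,_; proj₁; proj₂; ∃-syntax)
open import Data.List using (List; []; _∷_; _++_; length; map; filter; foldl)
open import Data.List.Membership.Propositional using (_∈_)
open import Data.List.Membership.DecPropositional _≟_ using (_∈?_)
open import Data.List.Relation.Unary.All using (All)
open import Data.List.Relation.Unary.Any using (Any; any?)
open import Data.List.Relation.Unary.Unique.Propositional using (Unique)
open import Data.List.Relation.Binary.Permutation.Propositional using (_↭_)
open import Data.Integer using (ℤ; +_; _-_)
open import Relation.Binary.PropositionalEquality using (_≡_)

-- Child order is irrelevant to all notions below.
data BTree : Set where
  leaf : ℕ → BTree
  node : BTree → BTree → BTree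

leaves : BTree → List ℕ
leaves (leaf x)   = x ∷ []
leaves (node l r) = leaves l ++ leaves r

-- T is a binary phylogenetic X-tree: its leaves are bijectively labelled by X
-- (X is given as a duplicate-free list; see lemma15).
IsPhyloTree : List ℕ → BTree → Set
IsPhyloTree X T = leaves T ↭ X

isCherryNode : ℕ → ℕ → BTree → BTree → Bool
isCherryNode x y (leaf a) (leaf b) = ((a ≡ᵇ x) ∧ (b ≡ᵇ y)) ∨ ((a ≡ᵇ y) ∧ (b ≡ᵇ x))
isCherryNode x y _ _ = false

-- Picking (x , y): if {x , y} is a cherry, delete leaf x and suppress the
-- parent of y (i.e. the cherry node becomes the leaf y); otherwise nothing
-- changes.  (Leaf labels are distinct, so there is at most one such node.)
pick : ℕ → ℕ → BTree → BTree
pick x y (leaf z) = leaf z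
pick x y (node l r) =
  if isCherryNode x y l r then leaf y else node (pick x y l) (pick x y r)

applySeq : List (ℕ × ℕ) → BTree → BTree
applySeq S T = foldl (λ t p → pick (proj₁ p) (proj₂ p) t) T S

-- A (general) sequence ⟨(x_1,y_1),…,(x_r,y_r),(x_{r+1},-),…,(x_s,-)⟩ is
-- represented by the pair (ps , ss) of its pair part and its single part.
seqLength : List (ℕ × ℕ) → List ℕ → ℕ
seqLength ps ss = length ps Data.Nat.+ length ss

weight : List ℕ → List (ℕ × ℕ) → List ℕ → ℤ
weight X ps ss = + seqLength ps ss - + length X

record IsCPS (X : List ℕ) (𝒯 : List BTree) (ps : List (ℕ × ℕ)) (ss : List ℕ) : Set where
  field
    singles-nonempty : 0 Data.Nat.< length ss
    pairs-in-X  : All (λ p → proj₁ p ∈ X × proj₂ p ∈ X) ps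
    singles-in-X : All (λ x → x ∈ X) ss
    -- {x_1,…,x_s} ⊇ X (⊆ is given by the two fields above)
    covers-X : All (λ x → x ∈ map proj₁ ps ++ ss) X
    reduces : All (λ T → ∃[ z ] (applySeq ps T ≡ leaf z × z ∈ ss)) 𝒯

n′ : List ℕ → List BTree → List (ℕ × ℕ) → ℕ
n′ X 𝒯 S = length (filter (λ x → any? (λ T → x ∈? leaves T) (map (applySeq S) 𝒯)) X)

k′ : List ℕ → List BTree → List (ℕ × ℕ) → ℤ
k′ X 𝒯 S = (+ length S - + length X) Data.Integer.+ + n′ X 𝒯 S

-- A label that still occurs in some tree of 𝒯/S must disappear before the
-- solution ends, and a label leaves a tree only as the first coordinate of a
-- picked pair; otherwise it is the final single leaf of that tree.  So the
-- n'(𝒯,S) distinct surviving labels inject into the remainder S' of the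
-- solution, and |S'| ≥ n'(𝒯,S) is exactly the inequality w(S ∘ S') ≥ k'(𝒯,S).
module Submission where

open import Defs
open import Data.Nat using (ℕ; suc; _≡ᵇ_; _≟_; z≤n; s≤s) renaming (_≤_ to _≤ℕ_; _+_ to _+ℕ_)
open import Data.Nat.Properties using (≡ᵇ⇒≡; +-assoc; +-monoʳ-≤) renaming (module ≤-Reasoning to ℕ-≤-Reasoning)
open import Data.Bool using (true; false; T)
open import Data.Bool.Properties using (T-≡; T-∧; T-∨)
open import Data.Product using (_×_; _,_; proj₁; proj₂)
open import Data.Sum using (_⊎_; inj₁; inj₂; [_,_]′; map₁; map₂)
open import Data.List using (List; []; _∷_; _++_; length; map; filter)
open import Data.List.Properties using (foldl-++; length-++; length-map; length-removeAt′)
open import Data.List.Membership.Propositional using (_∈_)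
open import Data.List.Membership.Propositional.Properties using (∈-filter⁻; ∈-++⁻; ∈-++⁺ˡ; ∈-++⁺ʳ)
open import Data.List.Membership.DecPropositional _≟_ using (_∈?_)
open import Data.List.Relation.Binary.Subset.Propositional using (_⊆_)
open import Data.List.Relation.Unary.All as All using (All)
open import Data.List.Relation.Unary.Any as Any using (Any; any?; here; there; _─_)
open import Data.List.Relation.Unary.Any.Properties using (map⁻)
open import Data.List.Relation.Unary.AllPairs using (_∷_)
open import Data.List.Relation.Unary.Unique.Propositional using (Unique)
open import Data.List.Relation.Unary.Unique.Propositional.Properties using (filter⁺)
open import Data.Integer using (+_; _-_; -_; _≥_; _≤_; +≤+) renaming (_+_ to _⊕_)
open import Data.Integer.Properties using (pos-+; +-monoˡ-≤; module ≤-Reasoning) renaming (+-assoc to ⊕-assoc; +-comm to ⊕-comm)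
open import Function using (Equivalence; _∘_)
open import Relation.Nullary using (Dec; contradiction)
open import Relation.Binary.PropositionalEquality using (_≡_; _≢_; refl; sym; trans; cong; subst)

∈-─ : ∀ {A : Set} {x y : A} {ys : List A} (x∈ys : x ∈ ys) → y ∈ ys → x ≢ y → y ∈ (ys ─ x∈ys)
∈-─ (here refl) (here refl) x≢y = contradiction refl x≢y
∈-─ (here refl) (there y∈ys) _ = y∈ys
∈-─ (there _)   (here y≡z)   _ = here y≡z
∈-─ (there x∈ys) (there y∈ys) x≢y = there (∈-─ x∈ys y∈ys x≢y)

Unique-⊆⇒length≤ : {A : Set} {xs ys : List A} → Unique xs → xs ⊆ ys → length xs ≤ℕ length ys
Unique-⊆⇒length≤ {xs = []} _ _ = z≤n
Unique-⊆⇒length≤ {xs = x ∷ xs} {ys} (x∉xs ∷ u) xs⊆ys =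
  subst (suc (length xs) ≤ℕ_) (sym (length-removeAt′ ys (Any.index x∈ys)))
    (s≤s (Unique-⊆⇒length≤ u (λ y∈xs → ∈-─ x∈ys (xs⊆ys (there y∈xs)) (All.lookup x∉xs y∈xs))))
  where
  x∈ys : x ∈ ys
  x∈ys = xs⊆ys (here refl)

isCherryNode-leaf⇒ : ∀ {a b u v} → T (isCherryNode a b (leaf u) (leaf v)) →
                     (u ≡ a × v ≡ b) ⊎ (u ≡ b × v ≡ a)
isCherryNode-leaf⇒ {a} {b} {u} {v} isCherry =
  [ inj₁ ∘ both a b ∘ Equivalence.to T-∧ , inj₂ ∘ both b a ∘ Equivalence.to T-∧ ]′
    (Equivalence.to T-∨ isCherry)
  where
  both : ∀ c d → T (u ≡ᵇ c) × T (v ≡ᵇ d) → u ≡ c × v ≡ d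
  both c d (u≡c , v≡d) = ≡ᵇ⇒≡ u c u≡c , ≡ᵇ⇒≡ v d v≡d

cherry-leaves : ∀ {a b x} l r → T (isCherryNode a b l r) → x ∈ leaves (node l r) → x ≡ a ⊎ x ≡ b
cherry-leaves {a} {b} (leaf u) (leaf v) isCherry x∈ with isCherryNode-leaf⇒ {a} {b} {u} {v} isCherry | x∈
... | inj₁ (refl , _) | here refl         = inj₁ refl
... | inj₁ (_ , refl) | there (here refl) = inj₂ refl
... | inj₂ (refl , _) | here refl         = inj₂ refl
... | inj₂ (_ , refl) | there (here refl) = inj₁ refl

∈-leaves-pick : ∀ a b t {x} → x ∈ leaves t → x ≡ a ⊎ x ∈ leaves (pick a b t)
∈-leaves-pick a b (leaf _) x∈ = inj₂ x∈
∈-leaves-pick a b (node l r) x∈ with isCherryNode a b l r in isCherry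
... | true  = map₂ here (cherry-leaves l r (Equivalence.from T-≡ isCherry) x∈)
... | false = [ map₂ ∈-++⁺ˡ ∘ ∈-leaves-pick a b l
              , map₂ (∈-++⁺ʳ (leaves (pick a b l))) ∘ ∈-leaves-pick a b r
              ]′ (∈-++⁻ (leaves l) x∈)

∈-leaves-applySeq : ∀ ps t {x} → x ∈ leaves t → x ∈ map proj₁ ps ⊎ x ∈ leaves (applySeq ps t)
∈-leaves-applySeq []             t x∈ = inj₂ x∈
∈-leaves-applySeq ((a , b) ∷ ps) t x∈ =
  [ inj₁ ∘ here , map₁ there ∘ ∈-leaves-applySeq ps (pick a b t) ]′ (∈-leaves-pick a b t x∈)

applySeq-++ : ∀ S ps t → applySeq (S ++ ps) t ≡ applySeq ps (applySeq S t)
applySeq-++ S ps t = foldl-++ _ t S ps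

∈-leaves-applySeq-leaf : ∀ S ps t {x z} → applySeq (S ++ ps) t ≡ leaf z →
                         x ∈ leaves (applySeq S t) → x ∈ map proj₁ ps ⊎ x ≡ z
∈-leaves-applySeq-leaf S ps t {x} reduced x∈
  with ∈-leaves-applySeq ps (applySeq S t) x∈
... | inj₁ picked = inj₁ picked
... | inj₂ x∈final with subst (λ t′ → x ∈ leaves t′) (trans (sym (applySeq-++ S ps t)) reduced) x∈final
...   | here x≡z = inj₂ x≡z

survives? : (𝒯 : List BTree) (S : List (ℕ × ℕ)) (x : ℕ) →
            Dec (Any (λ T → x ∈ leaves T) (map (applySeq S) 𝒯))
survives? 𝒯 S x = any? (λ T → x ∈? leaves T) (map (applySeq S) 𝒯)

survivors⊆pickedLater : ∀ {X 𝒯 S ps ss} → IsCPS X 𝒯 (S ++ ps) ss →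
                        filter (survives? 𝒯 S) X ⊆ map proj₁ ps ++ ss
survivors⊆pickedLater {X} {𝒯} {S} {ps} cps x∈survivors
  with All.lookupAny (IsCPS.reduces cps) (map⁻ (proj₂ (∈-filter⁻ (survives? 𝒯 S) {xs = X} x∈survivors)))
... | (z , reduced , z∈ss) , x∈
  with ∈-leaves-applySeq-leaf S ps _ reduced x∈
...   | inj₁ picked = ∈-++⁺ˡ picked
...   | inj₂ refl   = ∈-++⁺ʳ (map proj₁ ps) z∈ss

n′≤pickedLater : ∀ {X 𝒯 S ps ss} → Unique X → IsCPS X 𝒯 (S ++ ps) ss →
                 n′ X 𝒯 S ≤ℕ length ps +ℕ length ss
n′≤pickedLater {X} {𝒯} {S} {ps} {ss} uniqueX cps =
  subst (n′ X 𝒯 S ≤ℕ_) length-pickedLater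
    (Unique-⊆⇒length≤ (filter⁺ (survives? 𝒯 S) uniqueX) (survivors⊆pickedLater {S = S} {ps} cps))
  where
  length-pickedLater : length (map proj₁ ps ++ ss) ≡ length ps +ℕ length ss
  length-pickedLater = trans (length-++ (map proj₁ ps)) (cong (_+ℕ length ss) (length-map proj₁ ps))

[m-q]+n≤p-q : ∀ {m n p} q → m +ℕ n ≤ℕ p → (+ m - + q) ⊕ + n ≤ + p - + q
[m-q]+n≤p-q {m} {n} {p} q m+n≤p = begin
  (+ m - + q) ⊕ + n   ≡⟨ ⊕-assoc (+ m) (- + q) (+ n) ⟩
  + m ⊕ (- + q ⊕ + n) ≡⟨ cong (+ m ⊕_) (⊕-comm (- + q) (+ n)) ⟩
  + m ⊕ (+ n - + q)   ≡⟨ sym (⊕-assoc (+ m) (+ n) (- + q)) ⟩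
  (+ m ⊕ + n) - + q   ≡⟨ cong (_- + q) (sym (pos-+ m n)) ⟩
  + (m +ℕ n) - + q    ≤⟨ +-monoˡ-≤ (- + q) (+≤+ m+n≤p) ⟩
  + p - + q           ∎
  where open ≤-Reasoning

lemma15 : (X : List ℕ) → Unique X →
          (𝒯 : List BTree) → All (IsPhyloTree X) 𝒯 →
          (S : List (ℕ × ℕ)) → All (λ p → proj₁ p ∈ X × proj₂ p ∈ X) S →
          (ps : List (ℕ × ℕ)) (ss : List ℕ) → IsCPS X 𝒯 (S ++ ps) ss →
          weight X (S ++ ps) ss ≥ k′ X 𝒯 S
lemma15 X uniqueX 𝒯 _ S _ ps ss cps = [m-q]+n≤p-q (length X) (begin
  length S +ℕ n′ X 𝒯 S                 ≤⟨ +-monoʳ-≤ (length S) (n′≤pickedLater {S = S} {ps} uniqueX cps) ⟩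
  length S +ℕ (length ps +ℕ length ss) ≡⟨ sym (+-assoc (length S) (length ps) (length ss)) ⟩
  length S +ℕ length ps +ℕ length ss   ≡⟨ cong (_+ℕ length ss) (sym (length-++ S)) ⟩
  length (S ++ ps) +ℕ length ss        ∎)
  where open ℕ-≤-Reasoning
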